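{- For every $\varepsilon\in(0,1)$ and nonnegative integers $m\ge h$ there exists a positive integer $M=M(\varepsilon,m,h)$ such that the following holds. Suppose we have nonempty finite sets $\mathcal{P}^{rt}$ for $1\le r<t\le M$ and further sets $\mathcal{P}^{rt}_{s}\subseteq\mathcal{P}^{rt}$ with $|\mathcal{P}^{rt}_{s}|\ge\varepsilon|\mathcal{P}^{rt}|$ for $1\le r<s<t\le M$. Then there are indices $n_1<\dots<n_m$ in $[M]$ and elements $P^{n_rn_t}\in\mathcal{P}^{n_rn_t}$ for all $1\le r<t\le m$ with $r\le h$ such that \[ P^{n_rn_t}\in\bigcap\bigl\{\mathcal{P}^{n_rn_t}_{n_s}\colon s\in[m],\ r<s<t\bigr\}. \]
   Formalization: The parameter ε ranges over the rationals in the interval (0,1). -}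

module Defs where

open import Data.Nat using (ℕ)
open import Data.Integer using (+_)
open import Data.Rational using (ℚ; _/_)

ℕ→ℚ : ℕ → ℚ
ℕ→ℚ k = + k / 1

module Submission where

-- Write q for the denominator of ε; then ε ≥ 1/q, so the density
-- hypothesis gives |𝒫ʳᵗ| ≤ q·|𝒫ʳᵗₛ|.  Colour a list a < s₁ < ⋯ < s_d < b of indices
-- "true" when some point of 𝒫ᵃᵇ lies in every 𝒫ᵃᵇₛᵢ.  By double counting, among
-- d·q indices strictly between a and b some point of 𝒫ᵃᵇ lies in d of the sets
-- 𝒫ᵃᵇₛ, so no list of length 2 + d·q is coloured "false" on all of its
-- (d+2)-element sublists.  Ramsey's theorem, applied once for each size 0,…,m,
-- then yields m indices all of whose sublists are coloured "true"; taking for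
-- r < t the sublist of the indices from n_r to n_t gives the points Pʳᵗ.

open import Defs
open import Data.Bool using (Bool; true; false)
open import Data.Bool.Properties using (T-≡)
open import Data.Empty using (⊥-elim)
open import Data.Fin using (Fin; zero; suc; toℕ; fromℕ<; cast; _<_)
open import Data.Fin.Properties using (<-trans; <-irrefl; _<?_; any?; toℕ-cast)
open import Data.Fin.Subset using (Subset; _∈_; ∣_∣)
open import Data.Fin.Subset.Properties using (_∈?_)
open import Data.Vec using ([]; _∷_) renaming (tail to Vec-tail)
open import Data.List using (List; []; _∷_; length; take; filter; map; _++_; [_]; allFin; lookup; initLast; _∷ʳ′_)
open import Data.List.Properties using (length-take; length-++; filter-none; length-tabulate)
open import Data.List.Membership.Propositional using () renaming (_∈_ to _∈ₗ_)
open import Data.List.Membership.Propositional.Properties using (∈-lookup; ∈-filter⁺)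
open import Data.List.Relation.Binary.Sublist.Propositional using (_⊆_; []; _∷_; _∷ʳ_; ⊆-refl; ⊆-trans; minimum)
open import Data.List.Relation.Binary.Sublist.Propositional.Properties using (take-⊆; filter-⊆; ++⁺; length-mono-≤; All-resp-⊆)
open import Data.List.Relation.Unary.All as All using (All; []; _∷_)
open import Data.List.Relation.Unary.All.Properties using (all-filter; ∷ʳ⁻)
open import Data.List.Relation.Unary.Any using (here; there)
open import Data.List.Relation.Unary.AllPairs as AllPairs using (AllPairs; []; _∷_)
open import Data.List.Relation.Unary.AllPairs.Properties using (tabulate⁺-<)
open import Data.Nat as ℕ using (ℕ; zero; suc; _+_; _*_; _∸_; _≤_; z≤n; s≤s; NonZero)
open import Data.Nat.ListAction using (sum)
import Data.Nat.Properties as ℕP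
open import Algebra.Properties.CommutativeSemigroup ℕP.+-commutativeSemigroup using () renaming (interchange to +-interchange)
open import Data.Nat.Coprimality using (1-coprimeTo) renaming (sym to coprime-sym)
open import Data.Integer as ℤ using (+_; +[1+_]; -[1+_]; +0; +<+)
import Data.Integer.Properties as ℤP
open import Data.Rational as ℚ using (ℚ; mkℚ; 0ℚ; 1ℚ; ↧ₙ_; toℚᵘ; *<*)
import Data.Rational.Properties as ℚP
open import Data.Rational.Unnormalised as ℚᵘ using (mkℚᵘ; *≤*)
import Data.Rational.Unnormalised.Properties as ℚᵘP
open import Data.Product using (Σ; Σ-syntax; _×_; _,_; proj₁; proj₂)
open import Data.Sum using (_⊎_; inj₁; inj₂)
open import Function using (_∘_; id; Equivalence)
open import Relation.Nullary using (¬_; Dec; yes; no; does)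
open import Relation.Nullary.Decidable using (isYes; _×-dec_; toWitness; fromWitness)
open import Relation.Unary using (Decidable)
open import Relation.Binary.Definitions using (Transitive; Irreflexive) renaming (Decidable to Decidable₂)
open import Relation.Binary.PropositionalEquality using (_≡_; refl; sym; trans; cong; subst; subst₂; cong₂; module ≡-Reasoning)

-- Colourings of sublists and Ramsey's theorem

module _ {A : Set} where

  Monochromatic : (List A → Bool) → ℕ → Bool → List A → Set
  Monochromatic c k b Y = ∀ {Z} → Z ⊆ Y → length Z ≡ k → c Z ≡ b

  MonoSublist : (List A → Bool) → ℕ → Bool → ℕ → List A → Set
  MonoSublist c k b s X = Σ[ Y ∈ List A ] (Y ⊆ X × length Y ≡ s × Monochromatic c k b Y)

  mono-⊆ : ∀ {c k b Y Y′} → Y ⊆ Y′ → Monochromatic c k b Y′ → Monochromatic c k b Y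
  mono-⊆ Y⊆Y′ mono Z⊆Y = mono (⊆-trans Z⊆Y Y⊆Y′)

  monoSublist-⊆ : ∀ {c k b s X X′} → X ⊆ X′ → MonoSublist c k b s X → MonoSublist c k b s X′
  monoSublist-⊆ X⊆X′ (Y , Y⊆X , |Y| , mono) = Y , ⊆-trans Y⊆X X⊆X′ , |Y| , mono

  sublist-of-length : ∀ n (X : List A) → n ≤ length X → Σ[ Y ∈ List A ] (Y ⊆ X × length Y ≡ n)
  sublist-of-length n X n≤|X| = take n X , take-⊆ n X , trans (length-take n X) (ℕP.m≤n⇒m⊓n≡m n≤|X|)

  -- The only 0-element sublist is [], so its colour decides the case k = 0.
  mono-zero : ∀ {c b Y} → c [] ≡ b → Monochromatic c 0 b Y
  mono-zero c[]≡b {[]} _ _ = c[]≡b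

  mono-[] : ∀ {c k b} → Monochromatic c (suc k) b []
  mono-[] [] ()

  -- A (k+1)-sublist of v ∷ Y either avoids v, or is v followed by a k-sublist of Y;
  -- the latter are coloured by the "link" colouring Z ↦ c (v ∷ Z).
  mono-∷ : ∀ {c k b v Y} → Monochromatic (λ Z → c (v ∷ Z)) k b Y →
           Monochromatic c (suc k) b Y → Monochromatic c (suc k) b (v ∷ Y)
  mono-∷ link mono (_ ∷ʳ Z⊆Y) |Z| = mono Z⊆Y |Z|
  mono-∷ link mono (refl ∷ Z⊆Y) |Z| = link Z⊆Y (ℕP.suc-injective |Z|)

  extend : ∀ {c k b s v Y} → Monochromatic (λ Z → c (v ∷ Z)) k b Y →
           MonoSublist c (suc k) b s Y → MonoSublist c (suc k) b (suc s) (v ∷ Y)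
  extend {v = v} link (Y′ , Y′⊆Y , |Y′| , mono) =
    v ∷ Y′ , refl ∷ Y′⊆Y , cong suc |Y′| , mono-∷ (mono-⊆ Y′⊆Y link) mono

RamseyBound : ℕ → ℕ → ℕ → ℕ → Set₁
RamseyBound k s t R = ∀ {A : Set} (c : List A → Bool) (X : List A) → R ≤ length X →
  MonoSublist c k true s X ⊎ MonoSublist c k false t X

-- The Erdős–Szekeres step R(k+1; s+1, t+1) ≤ 1 + R(k; R(k+1; s, t+1), R(k+1; s+1, t)):
-- the first entry v splits off, and the rest is searched with the link colouring.
ramsey-step : ∀ {k s t R₁ R₂ C} → RamseyBound (suc k) s (suc t) R₁ → RamseyBound (suc k) (suc s) t R₂ →
              RamseyBound k R₁ R₂ C → RamseyBound (suc k) (suc s) (suc t) (suc C)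
ramsey-step bound₁ bound₂ boundₗ c (v ∷ X) (s≤s C≤|X|) with boundₗ (λ Z → c (v ∷ Z)) X C≤|X|
... | inj₁ (Y , Y⊆X , |Y| , link) with bound₁ c Y (ℕP.≤-reflexive (sym |Y|))
...   | inj₁ trueSub  = inj₁ (monoSublist-⊆ (refl ∷ Y⊆X) (extend link trueSub))
...   | inj₂ falseSub = inj₂ (monoSublist-⊆ (v ∷ʳ Y⊆X) falseSub)
ramsey-step bound₁ bound₂ boundₗ c (v ∷ X) (s≤s C≤|X|) | inj₂ (Y , Y⊆X , |Y| , link) with bound₂ c Y (ℕP.≤-reflexive (sym |Y|))
...   | inj₁ trueSub  = inj₁ (monoSublist-⊆ (v ∷ʳ Y⊆X) trueSub)
...   | inj₂ falseSub = inj₂ (monoSublist-⊆ (refl ∷ Y⊆X) (extend link falseSub))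

ramsey : ∀ k s t → Σ ℕ (RamseyBound k s t)
ramsey zero s t = s + t , bound
  where
  bound : RamseyBound 0 s t (s + t)
  bound c X s+t≤|X| with c [] in c[]
  ... | true  = let (Y , Y⊆X , |Y|) = sublist-of-length s X (ℕP.≤-trans (ℕP.m≤m+n s t) s+t≤|X|)
                in inj₁ (Y , Y⊆X , |Y| , mono-zero {c = c} c[])
  ... | false = let (Y , Y⊆X , |Y|) = sublist-of-length t X (ℕP.≤-trans (ℕP.m≤n+m t s) s+t≤|X|)
                in inj₂ (Y , Y⊆X , |Y| , mono-zero {c = c} c[])
ramsey (suc k) zero t = 0 , λ c X _ → inj₁ ([] , minimum X , refl , mono-[] {c = c})
ramsey (suc k) (suc s) zero = 0 , λ c X _ → inj₂ ([] , minimum X , refl , mono-[] {c = c})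
ramsey (suc k) (suc s) (suc t) =
  let (R₁ , bound₁) = ramsey (suc k) s (suc t)
      (R₂ , bound₂) = ramsey (suc k) (suc s) t
      (C , boundₗ) = ramsey k R₁ R₂
  in suc C , ramsey-step bound₁ bound₂ boundₗ

Sparse : {A : Set} → (List A → Bool) → ℕ → ℕ → List A → Set
Sparse c k T X = ∀ {Y} → Y ⊆ X → length Y ≡ T → ¬ Monochromatic c k false Y

sparse-⊆ : ∀ {A : Set} {c : List A → Bool} {k T X X′} → X ⊆ X′ → Sparse c k T X′ → Sparse c k T X
sparse-⊆ X⊆X′ sparse Y⊆X = sparse (⊆-trans Y⊆X X⊆X′)

IteratedBound : (ℕ → ℕ) → ℕ → ℕ → ℕ → Set₁
IteratedBound T j K R = ∀ {A : Set} (c : List A → Bool) (X : List A) →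
  (∀ k → k ℕ.< j → Sparse c k (T k) X) → R ≤ length X →
  Σ[ H ∈ List A ] (H ⊆ X × length H ≡ K × (∀ k → k ℕ.< j → Monochromatic c k true H))

-- Ramsey's theorem applied once per size: sparsity rules out the false alternative.
iterated-ramsey : ∀ T j K → Σ ℕ (IteratedBound T j K)
iterated-ramsey T zero K = K , λ c X _ K≤|X| →
  let (H , H⊆X , |H|) = sublist-of-length K X K≤|X| in H , H⊆X , |H| , λ _ ()
iterated-ramsey T (suc j) K = R , bound
  where
  R′ R : ℕ
  R′ = proj₁ (iterated-ramsey T j K)
  R = proj₁ (ramsey j R′ (T j))
  bound : IteratedBound T (suc j) K R
  bound c X sparse R≤|X| with proj₂ (ramsey j R′ (T j)) c X R≤|X|
  ... | inj₂ (Y , Y⊆X , |Y| , allFalse) = ⊥-elim (sparse j (ℕP.n<1+n j) Y⊆X |Y| allFalse)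
  ... | inj₁ (Y , Y⊆X , |Y| , monoʲ)
    with proj₂ (iterated-ramsey T j K) c Y (λ k k<j → sparse-⊆ Y⊆X (sparse k (ℕP.m<n⇒m<1+n k<j))) (ℕP.≤-reflexive (sym |Y|))
  ...   | H , H⊆Y , |H| , mono = H , ⊆-trans H⊆Y Y⊆X , |H| , mono′
    where
    mono′ : ∀ k → k ℕ.< suc j → Monochromatic c k true H
    mono′ k k<1+j with ℕP.m<1+n⇒m<n∨m≡n k<1+j
    ... | inj₁ k<j  = mono k k<j
    ... | inj₂ refl = mono-⊆ H⊆Y monoʲ

-- Double counting for a family of subsets of Fin n indexed by a list

indicator : Bool → ℕ
indicator true  = 1
indicator false = 0

module _ {B : Set} where

  multiplicity : ∀ {n} → (B → Subset n) → Fin n → List B → ℕ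
  multiplicity F p xs = length (filter (λ x → p ∈? F x) xs)

  totalSize : ∀ {n} → (B → Subset n) → List B → ℕ
  totalSize F xs = sum (map (λ x → ∣ F x ∣) xs)

  length-filter-∷ : ∀ {P : B → Set} (P? : Decidable P) x xs →
    length (filter P? (x ∷ xs)) ≡ indicator (does (P? x)) + length (filter P? xs)
  length-filter-∷ P? x xs with does (P? x)
  ... | true  = refl
  ... | false = refl

  totalSize-split : ∀ {n} (F : B → Subset (suc n)) xs →
    totalSize F xs ≡ multiplicity F zero xs + totalSize (Vec-tail ∘ F) xs
  totalSize-split F [] = refl
  totalSize-split F (x ∷ xs) = begin
    ∣ F x ∣ + totalSize F xs
      ≡⟨ cong₂ _+_ (size-∷ (F x)) (totalSize-split F xs) ⟩
    (indicator (does (zero ∈? F x)) + ∣ Vec-tail (F x) ∣) + (multiplicity F zero xs + totalSize (Vec-tail ∘ F) xs)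
      ≡⟨ +-interchange (indicator (does (zero ∈? F x))) _ _ _ ⟩
    (indicator (does (zero ∈? F x)) + multiplicity F zero xs) + (∣ Vec-tail (F x) ∣ + totalSize (Vec-tail ∘ F) xs)
      ≡⟨ cong (_+ (∣ Vec-tail (F x) ∣ + totalSize (Vec-tail ∘ F) xs)) (sym (length-filter-∷ (λ y → zero ∈? F y) x xs)) ⟩
    multiplicity F zero (x ∷ xs) + totalSize (Vec-tail ∘ F) (x ∷ xs) ∎
    where
    open ≡-Reasoning
    size-∷ : ∀ {n} (S : Subset (suc n)) → ∣ S ∣ ≡ indicator (does (zero ∈? S)) + ∣ Vec-tail S ∣
    size-∷ (true ∷ S)  = refl
    size-∷ (false ∷ S) = refl

  multiplicity-suc : ∀ {n} (F : B → Subset (suc n)) p xs →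
    multiplicity F (suc p) xs ≡ multiplicity (Vec-tail ∘ F) p xs
  multiplicity-suc F p [] = refl
  multiplicity-suc F p (x ∷ xs) = begin
    multiplicity F (suc p) (x ∷ xs)
      ≡⟨ length-filter-∷ (λ y → suc p ∈? F y) x xs ⟩
    indicator (does (suc p ∈? F x)) + multiplicity F (suc p) xs
      ≡⟨ cong₂ _+_ (cong indicator (∈?-suc p (F x))) (multiplicity-suc F p xs) ⟩
    indicator (does (p ∈? Vec-tail (F x))) + multiplicity (Vec-tail ∘ F) p xs
      ≡⟨ sym (length-filter-∷ (λ y → p ∈? Vec-tail (F y)) x xs) ⟩
    multiplicity (Vec-tail ∘ F) p (x ∷ xs) ∎
    where
    open ≡-Reasoning
    ∈?-suc : ∀ {k} (i : Fin k) (S : Subset (suc k)) → does (suc i ∈? S) ≡ does (i ∈? Vec-tail S)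
    ∈?-suc i (b ∷ S) = refl

  double-count : ∀ {n} (F : B → Subset n) xs c → (∀ p → multiplicity F p xs ≤ c) → totalSize F xs ≤ c * n
  double-count {zero} F xs c _ = ℕP.≤-reflexive (trans (totalSize-zero xs) (sym (ℕP.*-zeroʳ c)))
    where
    totalSize-zero : ∀ ys → totalSize F ys ≡ 0
    totalSize-zero [] = refl
    totalSize-zero (y ∷ ys) with F y
    ... | [] = totalSize-zero ys
  double-count {suc n} F xs c bounded = begin
    totalSize F xs                                           ≡⟨ totalSize-split F xs ⟩
    multiplicity F zero xs + totalSize (Vec-tail ∘ F) xs    ≤⟨ ℕP.+-mono-≤ (bounded zero) (double-count (Vec-tail ∘ F) xs c bounded-tail) ⟩
    c + c * n                                                ≡⟨ sym (ℕP.*-suc c n) ⟩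
    c * suc n                                                ∎
    where
    open ℕP.≤-Reasoning
    bounded-tail : ∀ p → multiplicity (Vec-tail ∘ F) p xs ≤ c
    bounded-tail p = subst (_≤ c) (multiplicity-suc F p xs) (bounded (suc p))

  popular-point : ∀ {n} (F : B → Subset n) xs c → c * n ℕ.< totalSize F xs →
                  Σ[ p ∈ Fin n ] c ℕ.< multiplicity F p xs
  popular-point F xs c c*n<total with any? (λ p → c ℕ.<? multiplicity F p xs)
  ... | yes found = found
  ... | no none   = ⊥-elim (ℕP.<⇒≱ c*n<total (double-count F xs c (λ p → ℕP.≮⇒≥ (λ c<mₚ → none (p , c<mₚ)))))

-- From ε·x ≤ y to x ≤ q·y, where q is the denominator of ε > 0 (so that ε ≥ 1/q)

toℚᵘ-ℕ→ℚ : ∀ k → toℚᵘ (ℕ→ℚ k) ≡ mkℚᵘ (+ k) 0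
toℚᵘ-ℕ→ℚ k = cong toℚᵘ (ℚP.normalize-coprime (coprime-sym (1-coprimeTo k)))

denominator-bound : ∀ ε x y → 0ℚ ℚ.< ε → ε ℚ.* ℕ→ℚ x ℚ.≤ ℕ→ℚ y → x ≤ ↧ₙ ε * y
denominator-bound (mkℚ +0 d _) x y (*<* (+<+ ())) _
denominator-bound (mkℚ -[1+ a ] d _) x y (*<* ()) _
denominator-bound ε@(mkℚ +[1+ a ] d _) x y _ εx≤y = begin
  x                  ≤⟨ ℕP.m≤n*m x (suc a) ⟩
  suc a * x          ≤⟨ ℤP.drop‿+≤+ cross-multiplied ⟩
  y * suc (d * 1)    ≡⟨ ℕP.*-comm y (suc (d * 1)) ⟩
  suc (d * 1) * y    ≡⟨ cong (λ e → suc e * y) (ℕP.*-identityʳ d) ⟩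
  suc d * y          ∎
  where
  open ℕP.≤-Reasoning
  unnormalised : toℚᵘ ε ℚᵘ.* mkℚᵘ (+ x) 0 ℚᵘ.≤ mkℚᵘ (+ y) 0
  unnormalised = subst₂ ℚᵘ._≤_ (cong (toℚᵘ ε ℚᵘ.*_) (toℚᵘ-ℕ→ℚ x)) (toℚᵘ-ℕ→ℚ y)
    (ℚᵘP.≤-respˡ-≃ (ℚP.toℚᵘ-homo-* ε (ℕ→ℚ x)) (ℚP.toℚᵘ-mono-≤ εx≤y))
  -- unfolding ≤ on unnormalised fractions: (1+a)·x·1 ≤ y·(1+d)
  cross-multiplied : + (suc a * x) ℤ.≤ + (y * suc (d * 1))
  cross-multiplied with unnormalised
  ... | *≤* le = subst₂ ℤ._≤_ (trans (ℤP.*-identityʳ _) (sym (ℤP.pos-* (suc a) x))) (sym (ℤP.pos-* y _)) le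

AllPairs-⊆ : ∀ {A : Set} {R : A → A → Set} {xs ys} → xs ⊆ ys → AllPairs R ys → AllPairs R xs
AllPairs-⊆ [] [] = []
AllPairs-⊆ (_ ∷ʳ xs⊆ys) (_ ∷ Rys) = AllPairs-⊆ xs⊆ys Rys
AllPairs-⊆ (refl ∷ xs⊆ys) (Ry ∷ Rys) = All-resp-⊆ xs⊆ys Ry ∷ AllPairs-⊆ xs⊆ys Rys

AllPairs-last : ∀ {A : Set} {R : A → A → Set} xs {b} → AllPairs R (xs ++ [ b ]) → All (λ x → R x b) xs
AllPairs-last [] _ = []
AllPairs-last (x ∷ xs) (Rx ∷ Rxs) = proj₂ (∷ʳ⁻ Rx) ∷ AllPairs-last xs Rxs

length-snoc : ∀ {A : Set} (xs : List A) x → length (xs ++ [ x ]) ≡ suc (length xs)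
length-snoc xs x = trans (length-++ xs) (ℕP.+-comm (length xs) 1)

splitLast : ∀ {A : Set} → A → List A → List A × A
splitLast x [] = [] , x
splitLast x (y ∷ ys) = x ∷ proj₁ (splitLast y ys) , proj₂ (splitLast y ys)

splitLast-snoc : ∀ {A : Set} (x : A) xs y → splitLast x (xs ++ [ y ]) ≡ (x ∷ xs , y)
splitLast-snoc x [] y = refl
splitLast-snoc x (x′ ∷ xs) y = cong (λ (ms , b) → x ∷ ms , b) (splitLast-snoc x′ xs y)

allFin-increasing : ∀ {M} → AllPairs _<_ (allFin M)
allFin-increasing = tabulate⁺-< (λ i<j → i<j)

Between : {A : Set} → (A → A → Set) → A → A → A → Set
Between _≺_ a b x = a ≺ x × x ≺ b

module Increasing {A : Set} {_≺_ : A → A → Set} (≺-trans : Transitive _≺_)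
  (≺-irrefl : Irreflexive _≡_ _≺_) (between? : ∀ a b → Decidable (Between _≺_ a b)) where

  ≺-asym : ∀ {x y} → x ≺ y → ¬ y ≺ x
  ≺-asym x≺y y≺x = ≺-irrefl refl (≺-trans x≺y y≺x)

  lookup-increasing : ∀ {H : List A} → AllPairs _≺_ H → ∀ {i j} → i < j → lookup H i ≺ lookup H j
  lookup-increasing {x ∷ H} (x≺H ∷ _) {zero} {suc j} _ = All.lookup x≺H (∈-lookup j)
  lookup-increasing {x ∷ H} (_ ∷ increasing) {suc i} {suc j} (s≤s i<j) = lookup-increasing increasing i<j

  interval-from : ∀ {a b H} → AllPairs _≺_ H → All (a ≺_) H → b ∈ₗ H → filter (between? a b) H ++ [ b ] ⊆ H
  interval-from {a} {b} (b≺H ∷ _) _ (here refl) with between? a b b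
  ... | yes (_ , b≺b) = ⊥-elim (≺-irrefl refl b≺b)
  ... | no _ rewrite filter-none (between? a b) (All.map (λ b≺y (_ , y≺b) → ≺-asym b≺y y≺b) b≺H)
               = refl ∷ minimum _
  interval-from {a} {b} {x ∷ _} (x≺H ∷ increasing) (a≺x ∷ a≺H) (there b∈H) with between? a b x
  ... | yes _ = refl ∷ interval-from increasing a≺H b∈H
  ... | no x∉ = ⊥-elim (x∉ (a≺x , All.lookup x≺H b∈H))

  interval-⊆ : ∀ {a b H} → AllPairs _≺_ H → a ∈ₗ H → b ∈ₗ H → a ≺ b → a ∷ filter (between? a b) H ++ [ b ] ⊆ H
  interval-⊆ _ (here refl) (here refl) a≺a = ⊥-elim (≺-irrefl refl a≺a)
  interval-⊆ (b≺H ∷ _) (there a∈H) (here refl) a≺b = ⊥-elim (≺-asym (All.lookup b≺H a∈H) a≺b)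
  interval-⊆ {a} {b} (a≺H ∷ increasing) (here refl) (there b∈H) _ with between? a b a
  ... | yes (a≺a , _) = ⊥-elim (≺-irrefl refl a≺a)
  ... | no _ = refl ∷ interval-from increasing a≺H b∈H
  interval-⊆ {a} {b} {x ∷ _} (x≺H ∷ increasing) (there a∈H) (there b∈H) a≺b with between? a b x
  ... | yes (a≺x , _) = ⊥-elim (≺-asym a≺x (All.lookup x≺H a∈H))
  ... | no _ = x ∷ʳ interval-⊆ increasing a∈H b∈H a≺b

-- The length beyond which no list of indices is false on all its k-element sublists
-- (for the colouring below, whose densities are at least 1/q).
sparsity-bound : ℕ → ℕ → ℕ
sparsity-bound q k = 2 + (k ∸ 2) * q

-- The colouring of index lists by common points, for a family 𝒫ʳᵗ = Fin (N r t) with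
-- subsets 𝒫ʳᵗₛ = S r s t of density at least 1/q.
module CommonPoints {M : ℕ} (N : Fin M → Fin M → ℕ) (S : (r s t : Fin M) → Subset (N r t))
  (q : ℕ) .{{_ : NonZero q}}
  (nonempty : ∀ r t → r < t → 0 ℕ.< N r t)
  (dense : ∀ r s t → r < s → s < t → N r t ≤ q * ∣ S r s t ∣) where

  between? : ∀ a b → Decidable (Between (_<_ {M}) a b)
  between? a b x = (a <? x) ×-dec (x <? b)

  open Increasing <-trans <-irrefl between?

  CommonPoint : Fin M → List (Fin M) → Fin M → Set
  CommonPoint a ms b = Σ[ p ∈ Fin (N a b) ] All (λ s → p ∈ S a s b) ms

  commonPoint? : ∀ a ms b → Dec (CommonPoint a ms b)
  commonPoint? a ms b = any? (λ p → All.all? (λ s → p ∈? S a s b) ms)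

  -- a ∷ ms ++ [ b ] is coloured true iff a and b have a common point for ms;
  -- lists with fewer than two entries are coloured true.
  colour : List (Fin M) → Bool
  colour [] = true
  colour (a ∷ []) = true
  colour (a ∷ x ∷ xs) = isYes (commonPoint? a (proj₁ (splitLast x xs)) (proj₂ (splitLast x xs)))

  colour-snoc : ∀ a ms b → colour (a ∷ ms ++ [ b ]) ≡ isYes (commonPoint? a ms b)
  colour-snoc a [] b = refl
  colour-snoc a (x ∷ ms) b rewrite splitLast-snoc x ms b = refl

  colour-true⇒common : ∀ a ms b → colour (a ∷ ms ++ [ b ]) ≡ true → CommonPoint a ms b
  colour-true⇒common a ms b isTrue = toWitness (Equivalence.from T-≡ (trans (sym (colour-snoc a ms b)) isTrue))

  colour-false⇒no-common : ∀ a ms b → colour (a ∷ ms ++ [ b ]) ≡ false → ¬ CommonPoint a ms b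
  colour-false⇒no-common a ms b isFalse common
    with () ← trans (sym isFalse) (trans (colour-snoc a ms b) (Equivalence.to T-≡ (fromWitness common)))

  summed-density : ∀ {a b} mids → All (Between _<_ a b) mids →
                   length mids * N a b ≤ q * totalSize (λ s → S a s b) mids
  summed-density [] [] = z≤n
  summed-density {a} {b} (s ∷ mids) ((a<s , s<b) ∷ between) = begin
    N a b + length mids * N a b
      ≤⟨ ℕP.+-mono-≤ (dense a s b a<s s<b) (summed-density mids between) ⟩
    q * ∣ S a s b ∣ + q * totalSize (λ s′ → S a s′ b) mids
      ≡⟨ sym (ℕP.*-distribˡ-+ q ∣ S a s b ∣ _) ⟩
    q * totalSize (λ s′ → S a s′ b) (s ∷ mids) ∎
    where open ℕP.≤-Reasoning

  common-point : ∀ {a b} d mids → a < b → All (Between _<_ a b) mids → d * q ≤ length mids →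
                 Σ[ ms ∈ List (Fin M) ] (ms ⊆ mids × length ms ≡ d × CommonPoint a ms b)
  common-point {a} {b} d mids a<b between dq≤|mids| =
    let (p , d≤mult) = popular d total-size
        (ms , ms⊆ , |ms|) = sublist-of-length d (filter (λ s → p ∈? F s) mids) d≤mult
    in ms , ⊆-trans ms⊆ (filter-⊆ _ mids) , |ms| , p , All-resp-⊆ ms⊆ (all-filter _ mids)
    where
    F : Fin M → Subset (N a b)
    F s = S a s b
    total-size : d * N a b ≤ totalSize F mids
    total-size = ℕP.*-cancelˡ-≤ q (begin
      q * (d * N a b)        ≡⟨ sym (ℕP.*-assoc q d (N a b)) ⟩
      q * d * N a b          ≡⟨ cong (_* N a b) (ℕP.*-comm q d) ⟩
      d * q * N a b          ≤⟨ ℕP.*-monoˡ-≤ (N a b) dq≤|mids| ⟩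
      length mids * N a b    ≤⟨ summed-density mids between ⟩
      q * totalSize F mids   ∎)
      where open ℕP.≤-Reasoning
    -- a point lying in e of the sets, by pigeonhole (for e = 0 any point of 𝒫ᵃᵇ ≠ ∅)
    popular : ∀ e → e * N a b ≤ totalSize F mids → Σ[ p ∈ Fin (N a b) ] e ≤ multiplicity F p mids
    popular zero _ = fromℕ< (nonempty a b a<b) , z≤n
    popular (suc e) total = popular-point F mids e
      (ℕP.<-≤-trans (ℕP.+-monoˡ-< (e * N a b) (nonempty a b a<b)) total)

  -- An interval a ∷ mids ++ [ b ] of indices with d·q middle entries is not false on all
  -- its (d+2)-element sublists: by averaging, a ∷ ms ++ [ b ] is true for some d of them.
  no-false-interval : ∀ d a mids b → a ∷ mids ++ [ b ] ⊆ allFin M → length mids ≡ d * q →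
                      ¬ Monochromatic colour (suc (suc d)) false (a ∷ mids ++ [ b ])
  no-false-interval d a mids b Y⊆ |mids| allFalse =
    let (ms , ms⊆ , |ms| , common) = common-point d mids a<b (All.zip (a<mids , mids<b)) (ℕP.≤-reflexive (sym |mids|))
    in colour-false⇒no-common a ms b
         (allFalse (refl ∷ ++⁺ ms⊆ ⊆-refl) (cong suc (trans (length-snoc ms b) (cong suc |ms|)))) common
    where
    increasing : AllPairs _<_ (a ∷ mids ++ [ b ])
    increasing = AllPairs-⊆ Y⊆ allFin-increasing
    a<mids : All (a <_) mids
    a<mids = proj₁ (∷ʳ⁻ (AllPairs.head increasing))
    a<b : a < b
    a<b = proj₂ (∷ʳ⁻ (AllPairs.head increasing))
    mids<b : All (_< b) mids
    mids<b = AllPairs-last mids (AllPairs.tail increasing)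

  -- No list of sparsity-bound q k indices is false on all its k-element sublists: for
  -- k < 2 because short lists are coloured true, for k = d + 2 by no-false-interval.
  colour-sparse : ∀ k → Sparse colour k (sparsity-bound q k) (allFin M)
  colour-sparse zero _ _ allFalse with () ← allFalse {[]} (minimum _) refl
  colour-sparse (suc zero) {a ∷ _} _ _ allFalse with () ← allFalse {a ∷ []} (refl ∷ minimum _) refl
  colour-sparse (suc (suc d)) {a ∷ rest} Y⊆ |Y| with initLast rest
  ... | [] with () ← |Y|
  ... | mids ∷ʳ′ b = no-false-interval d a mids b Y⊆
        (ℕP.suc-injective (trans (sym (length-snoc mids b)) (ℕP.suc-injective |Y|)))

  Selection : ℕ → Set
  Selection m = Σ[ n ∈ (Fin m → Fin M) ] ((∀ i j → i < j → n i < n j) ×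
    Σ[ P ∈ ((r t : Fin m) → r < t → Fin (N (n r) (n t))) ]
      (∀ r s t → (r<s : r < s) → (s<t : s < t) → P r t (<-trans r<s s<t) ∈ S (n r) (n s) (n t)))

  -- m indices all of whose sublists are coloured true give a selection: for r < t take
  -- the common point of the interval of indices from n r to n t.
  selection-from-true : ∀ {m H} → H ⊆ allFin M → length H ≡ m →
                        (∀ k → k ℕ.< suc m → Monochromatic colour k true H) → Selection m
  selection-from-true {m} {H} H⊆ |H| allTrue = n , increasing , P , P∈
    where
    H-increasing : AllPairs _<_ H
    H-increasing = AllPairs-⊆ H⊆ allFin-increasing
    n : Fin m → Fin M
    n i = lookup H (cast (sym |H|) i)
    increasing : ∀ i j → i < j → n i < n j
    increasing i j i<j = lookup-increasing H-increasing
      (subst₂ ℕ._<_ (sym (toℕ-cast (sym |H|) i)) (sym (toℕ-cast (sym |H|) j)) i<j)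
    mids : Fin m → Fin m → List (Fin M)
    mids r t = filter (between? (n r) (n t)) H
    common : ∀ r t → r < t → CommonPoint (n r) (mids r t) (n t)
    common r t r<t = colour-true⇒common (n r) (mids r t) (n t)
      (allTrue _ (s≤s (ℕP.≤-trans (length-mono-≤ interval) (ℕP.≤-reflexive |H|))) interval refl)
      where
      interval : n r ∷ mids r t ++ [ n t ] ⊆ H
      interval = interval-⊆ H-increasing (∈-lookup _) (∈-lookup _) (increasing r t r<t)
    P : (r t : Fin m) → r < t → Fin (N (n r) (n t))
    P r t r<t = proj₁ (common r t r<t)
    P∈ : ∀ r s t → (r<s : r < s) → (s<t : s < t) → P r t (<-trans r<s s<t) ∈ S (n r) (n s) (n t)
    P∈ r s t r<s s<t = All.lookup (proj₂ (common r t (<-trans r<s s<t)))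
      (∈-filter⁺ (between? (n r) (n t)) (∈-lookup {xs = H} _) (increasing r s r<s , increasing s t s<t))

  selection : ∀ m {R} → IteratedBound (sparsity-bound q) (suc m) m R → R ≤ M → Selection m
  selection m bound R≤M =
    let (H , H⊆ , |H| , allTrue) = bound colour (allFin M) (λ k _ → colour-sparse k)
                                     (subst (_ ≤_) (sym (length-tabulate id)) R≤M)
    in selection-from-true H⊆ |H| allTrue

-- With q the denominator of ε, M = 1 + R for the iterated Ramsey bound R
-- works; the density hypothesis becomes |𝒫ʳᵗ| ≤ q·|𝒫ʳᵗₛ|.  The points are found for
-- all r < t.
lemma4p5 : (ε : ℚ) → 0ℚ ℚ.< ε → ε ℚ.< 1ℚ → (m h : ℕ) → h ≤ m →
    Σ[ M ∈ ℕ ] (0 ℕ.< M ×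
      ((N : Fin M → Fin M → ℕ) → (S : (r s t : Fin M) → Subset (N r t)) →
       (∀ r t → r < t → 0 ℕ.< N r t) →
       (∀ r s t → r < s → s < t → ε ℚ.* ℕ→ℚ (N r t) ℚ.≤ ℕ→ℚ ∣ S r s t ∣) →
       Σ[ n ∈ (Fin m → Fin M) ] ((∀ i j → i < j → n i < n j) ×
         Σ[ P ∈ ((r t : Fin m) → r < t → toℕ r ℕ.< h → Fin (N (n r) (n t))) ]
           (∀ r s t → (r<s : r < s) → (s<t : s < t) → (r<h : toℕ r ℕ.< h) →
             P r t (<-trans r<s s<t) r<h ∈ S (n r) (n s) (n t)))))
lemma4p5 ε 0<ε _ m h _ = suc R , s≤s z≤n , λ N S nonempty dense →
  let open CommonPoints N S (↧ₙ ε) nonempty (λ r s t r<s s<t → denominator-bound ε _ _ 0<ε (dense r s t r<s s<t))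
      (n , increasing , P , P∈) = selection m bound (ℕP.n≤1+n R)
  in n , increasing , (λ r t r<t _ → P r t r<t) , (λ r s t r<s s<t _ → P∈ r s t r<s s<t)
  where
  R : ℕ
  R = proj₁ (iterated-ramsey (sparsity-bound (↧ₙ ε)) (suc m) m)
  bound : IteratedBound (sparsity-bound (↧ₙ ε)) (suc m) m R
  bound = proj₂ (iterated-ramsey (sparsity-bound (↧ₙ ε)) (suc m) m)
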